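{- Let $G$ be a finite group having exactly one conjugacy class of elements of order $2$. Let $x\in G$ be an involution and let $\alpha=\sigma_x$, i.e. $\alpha(g)=xgx$ for $g\in G$. Then $|G_{ -\alpha}|=|\omega_\alpha(G)|+1$.
   Context: For $\alpha\in\mathrm{Aut}(G)$: $G_{ -\alpha}=\{g\in G: \alpha(g)=g^{ -1}\}$ and $\omega_\alpha(G)=\{\alpha(g)g^{ -1}: g\in G\}$. -}

module Defs where

open import Level using (Level; _⊔_) renaming (suc to lsuc)
open import Algebra.Bundles using (Group)
open import Data.Nat using (ℕ)
open import Data.Fin using (Fin)
open import Data.List using (List; length; filter; allFin)
open import Data.List.Relation.Unary.Any using (Any; any?)
open import Data.Product using (Σ; ∃; _×_; _,_)
open import Relation.Binary.PropositionalEquality using (_≡_)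
open import Relation.Binary.Definitions using (Decidable)
open import Relation.Nullary using (¬_; Dec)
open import Relation.Unary using (Pred)

record FiniteGroup (c ℓ : Level) : Set (lsuc (c ⊔ ℓ)) where
  field
    group : Group c ℓ
  open Group group public
  field
    _≟_      : Decidable _≈_
    size     : ℕ
    enum     : Fin size → Carrier
    enum-inj : ∀ i j → enum i ≈ enum j → i ≡ j
    enum-sur : ∀ g → ∃ λ i → enum i ≈ g
  infix 4 _≟_

module _ {c ℓ} (G : FiniteGroup c ℓ) where
  open FiniteGroup G

  countG : {p : Level} (P : Pred Carrier p) → (∀ g → Dec (P g)) → ℕ
  countG P P? = length (filter (λ i → P? (enum i)) (allFin size))

  IsInvolution : Carrier → Set ℓ
  IsInvolution g = (¬ (g ≈ ε)) × (g ∙ g ≈ ε)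

  Conjugate : Carrier → Carrier → Set (c ⊔ ℓ)
  Conjugate a b = ∃ λ h → h ∙ a ∙ h ⁻¹ ≈ b

  OneInvolutionClass : Set (c ⊔ ℓ)
  OneInvolutionClass =
    (∃ λ a → IsInvolution a) ×
    (∀ a b → IsInvolution a → IsInvolution b → Conjugate a b)

  card-G-α : (Carrier → Carrier) → ℕ
  card-G-α α = countG (λ g → α g ≈ g ⁻¹) (λ g → α g ≟ g ⁻¹)

  -- membership of h in ω_α(G) = { α(g) g⁻¹ : g ∈ G }, with g ranging over
  -- the enumeration of G (which covers all of G), hence decidable
  InOmegaEnum : (Carrier → Carrier) → Carrier → Set ℓ
  InOmegaEnum α h = Any (λ i → α (enum i) ∙ enum i ⁻¹ ≈ h) (allFin size)

  card-ω : (Carrier → Carrier) → ℕ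
  card-ω α = countG (InOmegaEnum α)
    (λ h → any? (λ i → α (enum i) ∙ enum i ⁻¹ ≟ h) (allFin size))

  σ : Carrier → Carrier → Carrier
  σ x g = x ∙ g ∙ x

module Submission where

-- The proof is a counting argument in three steps.
--  (1) Left multiplication by x maps { g : g² = ε } onto G_{-α}: indeed
--      α(x g) = g x and (x g)⁻¹ = g⁻¹ x, so α(x g) = (x g)⁻¹ iff g = g⁻¹.
--  (2) Left multiplication by x maps the set Inv(G) of involutions onto
--      ω_α(G): α(h) h⁻¹ = x (h x h⁻¹), and as h varies the conjugates
--      h x h⁻¹ are exactly the involutions, G having one class of them.
--  (3) { g : g² = ε } is the disjoint union of Inv(G) and { ε }.
-- Hence |G_{-α}| = |Inv(G)| + 1 = |ω_α(G)| + 1.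

open import Defs
open import Level using (Level)
open import Data.Nat using (ℕ; _+_)
open import Relation.Binary.PropositionalEquality using (_≡_)

open import Data.Nat using (suc)
open import Data.Nat.Properties using (+-0-commutativeMonoid)
open import Data.Fin using (Fin; zero; suc)
open import Data.Fin.Properties using (suc-injective) renaming (_≟_ to _≟ᶠ_)
open import Data.Fin.Permutation using (Permutation; permutation)
open import Data.List using (length; filter; tabulate; allFin)
import Data.List.Relation.Unary.Any as Any
open import Data.List.Membership.Propositional using (lose)
open import Data.List.Membership.Propositional.Properties using (∈-allFin)
open import Data.Product using (∃; _×_; _,_; proj₁; proj₂)
open import Data.Sum using (_⊎_; inj₁; inj₂; [_,_])
open import Data.Empty using (⊥-elim)
open import Function using (_⇔_; mk⇔; Equivalence)
open import Function.Construct.Composition using (_⇔-∘_)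
open import Function.Construct.Symmetry using (⇔-sym)
import Relation.Binary.PropositionalEquality as ≡
open import Relation.Binary.Definitions using (_Respects_)
open import Relation.Nullary using (¬_; Dec; yes; no; ¬?)
open import Relation.Nullary.Decidable using (_×-dec_)
open import Relation.Unary using (Pred; Decidable)

open import Algebra.Properties.CommutativeMonoid.Sum +-0-commutativeMonoid
  using (sum; sum-cong-≗; sum-replicate-zero; sum-permute; ∑-distrib-+)

indicator : ∀ {p} {P : Set p} → Dec P → ℕ
indicator (yes _) = 1
indicator (no _)  = 0

indicator-cong : ∀ {p q} {P : Set p} {Q : Set q} (P? : Dec P) (Q? : Dec Q) →
                 P ⇔ Q → indicator P? ≡ indicator Q?
indicator-cong (yes _) (yes _)  _   = ≡.refl
indicator-cong (no _)  (no _)   _   = ≡.refl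
indicator-cong (yes p) (no ¬q) P⇔Q = ⊥-elim (¬q (Equivalence.to P⇔Q p))
indicator-cong (no ¬p) (yes q) P⇔Q = ⊥-elim (¬p (Equivalence.from P⇔Q q))

indicator-⊎ : ∀ {p q r} {P : Set p} {Q : Set q} {R : Set r}
              (R? : Dec R) (P? : Dec P) (Q? : Dec Q) →
              R ⇔ (P ⊎ Q) → ¬ (P × Q) →
              indicator R? ≡ indicator P? + indicator Q?
indicator-⊎ (yes _) (yes p) (yes q) _      disj = ⊥-elim (disj (p , q))
indicator-⊎ (yes _) (yes _) (no _)  _      _    = ≡.refl
indicator-⊎ (yes _) (no _)  (yes _) _      _    = ≡.refl
indicator-⊎ (yes r) (no ¬p) (no ¬q) R⇔P⊎Q _    =
  ⊥-elim ([ ¬p , ¬q ] (Equivalence.to R⇔P⊎Q r))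
indicator-⊎ (no ¬r) (yes p) _       R⇔P⊎Q _    =
  ⊥-elim (¬r (Equivalence.from R⇔P⊎Q (inj₁ p)))
indicator-⊎ (no ¬r) (no _)  (yes q) R⇔P⊎Q _    =
  ⊥-elim (¬r (Equivalence.from R⇔P⊎Q (inj₂ q)))
indicator-⊎ (no _)  (no _)  (no _)  _      _    = ≡.refl

length-filter-tabulate : ∀ {a p} {A : Set a} {P : Pred A p} (P? : Decidable P)
                         {n} (f : Fin n → A) →
                         length (filter P? (tabulate f)) ≡ sum (λ i → indicator (P? (f i)))
length-filter-tabulate P? {0}     f = ≡.refl
length-filter-tabulate P? {suc n} f with P? (f zero)
... | yes _ = ≡.cong suc (length-filter-tabulate P? (λ i → f (suc i)))
... | no _  = length-filter-tabulate P? (λ i → f (suc i))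

sum-indicator-≡ : ∀ {n} (j : Fin n) → sum (λ i → indicator (i ≟ᶠ j)) ≡ 1
sum-indicator-≡ {suc n} zero =
  ≡.cong suc (≡.trans (sum-cong-≗ {n} (λ _ → ≡.refl)) (sum-replicate-zero n))
sum-indicator-≡ {suc n} (suc j) = ≡.trans
  (sum-cong-≗ {n} (λ i → indicator-cong (suc i ≟ᶠ suc j) (i ≟ᶠ j) (mk⇔ suc-injective (≡.cong suc))))
  (sum-indicator-≡ j)

module Counting {c ℓ} (G : FiniteGroup c ℓ) where
  open FiniteGroup G
  open import Algebra.Properties.Group group using (\\-leftDividesˡ; \\-leftDividesʳ)

  index : Carrier → Fin size
  index g = proj₁ (enum-sur g)

  enum-index : ∀ g → enum (index g) ≈ g
  enum-index g = proj₂ (enum-sur g)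

  countG-sum : ∀ {p} {P : Pred Carrier p} (P? : Decidable P) →
               countG G P P? ≡ sum (λ i → indicator (P? (enum i)))
  countG-sum P? = length-filter-tabulate (λ i → P? (enum i)) (λ i → i)

  countG-cong : ∀ {p q} {P : Pred Carrier p} {Q : Pred Carrier q}
                (P? : Decidable P) (Q? : Decidable Q) → (∀ g → P g ⇔ Q g) →
                countG G P P? ≡ countG G Q Q?
  countG-cong P? Q? P⇔Q = begin
    countG G _ P?                              ≡⟨ countG-sum P? ⟩
    sum (λ i → indicator (P? (enum i)))        ≡⟨ sum-cong-≗ (λ i → indicator-cong _ _ (P⇔Q (enum i))) ⟩
    sum (λ i → indicator (Q? (enum i)))        ≡⟨ countG-sum Q? ⟨
    countG G _ Q?                              ∎
    where open ≡.≡-Reasoning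

  countG-⊎ : ∀ {p q r} {P : Pred Carrier p} {Q : Pred Carrier q} {R : Pred Carrier r}
             (R? : Decidable R) (P? : Decidable P) (Q? : Decidable Q) →
             (∀ g → R g ⇔ (P g ⊎ Q g)) → (∀ g → ¬ (P g × Q g)) →
             countG G R R? ≡ countG G P P? + countG G Q Q?
  countG-⊎ R? P? Q? R⇔P⊎Q disj = begin
    countG G _ R?                                      ≡⟨ countG-sum R? ⟩
    sum (λ i → indicator (R? (enum i)))                ≡⟨ sum-cong-≗ (λ i → indicator-⊎ (R? (enum i)) (P? (enum i)) (Q? (enum i)) (R⇔P⊎Q (enum i)) (disj (enum i))) ⟩
    sum (λ i → indicator (P? (enum i)) + indicator (Q? (enum i)))
                                                       ≡⟨ ∑-distrib-+ (λ i → indicator (P? (enum i))) (λ i → indicator (Q? (enum i))) ⟩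
    sum (λ i → indicator (P? (enum i))) + sum (λ i → indicator (Q? (enum i)))
                                                       ≡⟨ ≡.cong₂ _+_ (countG-sum P?) (countG-sum Q?) ⟨
    countG G _ P? + countG G _ Q?                      ∎
    where open ≡.≡-Reasoning

  countG-singleton : ∀ a → countG G (_≈ a) (_≟ a) ≡ 1
  countG-singleton a = begin
    countG G (_≈ a) (_≟ a)                       ≡⟨ countG-sum (_≟ a) ⟩
    sum (λ i → indicator (enum i ≟ a))           ≡⟨ sum-cong-≗ (λ i → indicator-cong _ _ (enum-≈⇔≡ i)) ⟩
    sum (λ i → indicator (i ≟ᶠ index a))         ≡⟨ sum-indicator-≡ (index a) ⟩
    1                                            ∎
    where
    open ≡.≡-Reasoning
    enum-≈⇔≡ : ∀ i → (enum i ≈ a) ⇔ (i ≡ index a)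
    enum-≈⇔≡ i = mk⇔ (λ e → enum-inj _ _ (trans e (sym (enum-index a))))
                     (λ { ≡.refl → enum-index a })

  shift : Carrier → Fin size → Fin size
  shift b i = index (b ∙ enum i)

  shift-inverse : ∀ a b → (∀ g → a ∙ (b ∙ g) ≈ g) → ∀ i → shift a (shift b i) ≡ i
  shift-inverse a b cancel i = enum-inj _ _ (begin
    enum (shift a (shift b i))   ≈⟨ enum-index _ ⟩
    a ∙ enum (shift b i)         ≈⟨ ∙-congˡ (enum-index _) ⟩
    a ∙ (b ∙ enum i)             ≈⟨ cancel (enum i) ⟩
    enum i                       ∎)
    where open import Relation.Binary.Reasoning.Setoid setoid

  translation : Carrier → Permutation size size
  translation a = permutation (shift a) (shift (a ⁻¹))
    (shift-inverse a (a ⁻¹) (\\-leftDividesˡ a))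
    (shift-inverse (a ⁻¹) a (\\-leftDividesʳ a))

  countG-translate : ∀ {p} {P : Pred Carrier p} (P? : Decidable P) → P Respects _≈_ →
                     ∀ a → countG G P P? ≡ countG G (λ g → P (a ∙ g)) (λ g → P? (a ∙ g))
  countG-translate {P = P} P? resp a = begin
    countG G _ P?                                    ≡⟨ countG-sum P? ⟩
    sum (λ i → indicator (P? (enum i)))              ≡⟨ sum-permute _ (translation a) ⟩
    sum (λ i → indicator (P? (enum (shift a i))))    ≡⟨ sum-cong-≗ (λ i → indicator-cong (P? (enum (shift a i))) (P? (a ∙ enum i)) (resp-⇔ (enum-index (a ∙ enum i)))) ⟩
    sum (λ i → indicator (P? (a ∙ enum i)))          ≡⟨ countG-sum (λ g → P? (a ∙ g)) ⟨
    countG G _ (λ g → P? (a ∙ g))                    ∎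
    where
    open ≡.≡-Reasoning
    resp-⇔ : ∀ {g h} → g ≈ h → P g ⇔ P h
    resp-⇔ g≈h = mk⇔ (resp g≈h) (resp (sym g≈h))

  inOmega⇔ : (α : Carrier → Carrier) → (∀ {g h} → g ≈ h → α g ≈ α h) →
             ∀ h → InOmegaEnum G α h ⇔ (∃ λ g → α g ∙ g ⁻¹ ≈ h)
  inOmega⇔ α α-cong h = mk⇔ to from
    where
    to : InOmegaEnum G α h → ∃ λ g → α g ∙ g ⁻¹ ≈ h
    to inΩ with Any.satisfied inΩ
    ... | i , e = enum i , e
    from : (∃ λ g → α g ∙ g ⁻¹ ≈ h) → InOmegaEnum G α h
    from (g , e) = lose (∈-allFin (index g))
      (trans (∙-cong (α-cong (enum-index g)) (⁻¹-cong (enum-index g))) e)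

  inOmega-resp : ∀ α → InOmegaEnum G α Respects _≈_
  inOmega-resp α h≈h′ = Any.map (λ e → trans e h≈h′)

module Involutions {c ℓ} (G : FiniteGroup c ℓ) where
  open FiniteGroup G
  open import Algebra.Properties.Group group
    using (inverseʳ-unique; ⁻¹-anti-homo-∙; ⁻¹-involutive; ∙-cancelˡ; ∙-cancelʳ;
           x∙y⁻¹≈ε⇒x≈y; identityʳ-unique)
  open import Relation.Binary.Reasoning.Setoid setoid

  ≈-resp-⇔ : ∀ {a a′ b b′} → a ≈ a′ → b ≈ b′ → (a ≈ b) ⇔ (a′ ≈ b′)
  ≈-resp-⇔ a≈a′ b≈b′ =
    mk⇔ (λ a≈b → trans (sym a≈a′) (trans a≈b b≈b′))
        (λ a′≈b′ → trans a≈a′ (trans a′≈b′ (sym b≈b′)))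

  cancelʳ-⇔ : ∀ x g h → (g ∙ x ≈ h ∙ x) ⇔ (g ≈ h)
  cancelʳ-⇔ x g h = mk⇔ (∙-cancelʳ x g h) ∙-congʳ

  square-one⇔self-inverse : ∀ g → (g ∙ g ≈ ε) ⇔ (g ≈ g ⁻¹)
  square-one⇔self-inverse g =
    mk⇔ (inverseʳ-unique g g) (λ g≈g⁻¹ → trans (∙-congˡ g≈g⁻¹) (inverseʳ g))

  square-one⇔ : ∀ g → (g ∙ g ≈ ε) ⇔ (IsInvolution G g ⊎ g ≈ ε)
  square-one⇔ g = mk⇔ to [ proj₂ , (λ g≈ε → trans (∙-cong g≈ε g≈ε) (identityˡ ε)) ]
    where
    to : g ∙ g ≈ ε → IsInvolution G g ⊎ g ≈ ε
    to gg≈ε with g ≟ ε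
    ... | yes g≈ε = inj₂ g≈ε
    ... | no g≉ε  = inj₁ (g≉ε , gg≈ε)

  involution-resp : IsInvolution G Respects _≈_
  involution-resp a≈b (a≉ε , aa≈ε) =
    (λ b≈ε → a≉ε (trans a≈b b≈ε)) , trans (∙-cong (sym a≈b) (sym a≈b)) aa≈ε

  involution-self-inverse : ∀ {x} → IsInvolution G x → x ⁻¹ ≈ x
  involution-self-inverse {x} (_ , xx≈ε) = sym (inverseʳ-unique x x xx≈ε)

  conjugate-involution : ∀ {x} → IsInvolution G x → ∀ h → IsInvolution G (h ∙ x ∙ h ⁻¹)
  conjugate-involution {x} x-inv@(x≉ε , _) h =
    nontrivial , Equivalence.from (square-one⇔self-inverse C) (sym self-inverse)
    where
    C = h ∙ x ∙ h ⁻¹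
    nontrivial : ¬ (C ≈ ε)
    nontrivial C≈ε = x≉ε (identityʳ-unique h x (x∙y⁻¹≈ε⇒x≈y (h ∙ x) h C≈ε))
    self-inverse : C ⁻¹ ≈ C
    self-inverse = begin
      (h ∙ x ∙ h ⁻¹) ⁻¹      ≈⟨ ⁻¹-anti-homo-∙ (h ∙ x) (h ⁻¹) ⟩
      h ⁻¹ ⁻¹ ∙ (h ∙ x) ⁻¹   ≈⟨ ∙-cong (⁻¹-involutive h) (⁻¹-anti-homo-∙ h x) ⟩
      h ∙ (x ⁻¹ ∙ h ⁻¹)      ≈⟨ ∙-congˡ (∙-congʳ (involution-self-inverse x-inv)) ⟩
      h ∙ (x ∙ h ⁻¹)         ≈⟨ assoc h x (h ⁻¹) ⟨
      h ∙ x ∙ h ⁻¹           ∎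

  σ-translate : ∀ {x} → x ∙ x ≈ ε → ∀ g → σ G x (x ∙ g) ≈ g ∙ x
  σ-translate {x} xx≈ε g = ∙-congʳ (begin
    x ∙ (x ∙ g)   ≈⟨ assoc x x g ⟨
    x ∙ x ∙ g     ≈⟨ ∙-congʳ xx≈ε ⟩
    ε ∙ g         ≈⟨ identityˡ g ⟩
    g             ∎)

  inverse-translate : ∀ {x} → x ⁻¹ ≈ x → ∀ g → (x ∙ g) ⁻¹ ≈ g ⁻¹ ∙ x
  inverse-translate {x} x⁻¹≈x g = trans (⁻¹-anti-homo-∙ x g) (∙-congˡ x⁻¹≈x)

  σ-twisted⇔square-one : ∀ {x} → IsInvolution G x → ∀ g →
                         (σ G x (x ∙ g) ≈ (x ∙ g) ⁻¹) ⇔ (g ∙ g ≈ ε)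
  σ-twisted⇔square-one {x} x-inv@(_ , xx≈ε) g =
    ⇔-sym (square-one⇔self-inverse g)
      ⇔-∘ (cancelʳ-⇔ x g (g ⁻¹)
      ⇔-∘ ≈-resp-⇔ (σ-translate xx≈ε g) (inverse-translate (involution-self-inverse x-inv) g))

  σ-commutator : ∀ x h → σ G x h ∙ h ⁻¹ ≈ x ∙ (h ∙ x ∙ h ⁻¹)
  σ-commutator x h = begin
    x ∙ h ∙ x ∙ h ⁻¹       ≈⟨ assoc (x ∙ h) x (h ⁻¹) ⟩
    x ∙ h ∙ (x ∙ h ⁻¹)     ≈⟨ assoc x h (x ∙ h ⁻¹) ⟩
    x ∙ (h ∙ (x ∙ h ⁻¹))   ≈⟨ ∙-congˡ (assoc h x (h ⁻¹)) ⟨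
    x ∙ (h ∙ x ∙ h ⁻¹)     ∎

  σ-commutator⇔involution : OneInvolutionClass G → ∀ {x} → IsInvolution G x → ∀ g →
                            (∃ λ h → σ G x h ∙ h ⁻¹ ≈ x ∙ g) ⇔ IsInvolution G g
  σ-commutator⇔involution (_ , all-conjugate) {x} x-inv g = mk⇔ to from
    where
    to : (∃ λ h → σ G x h ∙ h ⁻¹ ≈ x ∙ g) → IsInvolution G g
    to (h , e) = involution-resp
      (∙-cancelˡ x _ _ (trans (sym (σ-commutator x h)) e))
      (conjugate-involution x-inv h)
    from : IsInvolution G g → ∃ λ h → σ G x h ∙ h ⁻¹ ≈ x ∙ g
    from g-inv with all-conjugate x g x-inv g-inv
    ... | h , hxh⁻¹≈g = h , trans (σ-commutator x h) (∙-congˡ hxh⁻¹≈g)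

module Counts {c ℓ} (G : FiniteGroup c ℓ) (one-class : OneInvolutionClass G)
              {x : FiniteGroup.Carrier G} (x-inv : IsInvolution G x) where
  open FiniteGroup G
  open Counting G
  open Involutions G
  open ≡.≡-Reasoning

  involution? : Decidable (IsInvolution G)
  involution? g = ¬? (g ≟ ε) ×-dec (g ∙ g ≟ ε)

  #involutions : ℕ
  #involutions = countG G (IsInvolution G) involution?

  card-G-α≡ : card-G-α G (σ G x) ≡ #involutions + 1
  card-G-α≡ = begin
    card-G-α G (σ G x)
      ≡⟨ countG-translate twisted? twisted-resp x ⟩
    countG G (λ g → σ G x (x ∙ g) ≈ (x ∙ g) ⁻¹) (λ g → twisted? (x ∙ g))
      ≡⟨ countG-cong (λ g → twisted? (x ∙ g)) square-one? (σ-twisted⇔square-one x-inv) ⟩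
    countG G (λ g → g ∙ g ≈ ε) square-one?
      ≡⟨ countG-⊎ square-one? involution? (_≟ ε) square-one⇔ (λ _ (g-inv , g≈ε) → proj₁ g-inv g≈ε) ⟩
    #involutions + countG G (_≈ ε) (_≟ ε)
      ≡⟨ ≡.cong (#involutions +_) (countG-singleton ε) ⟩
    #involutions + 1
      ∎
    where
    twisted? : ∀ g → Dec (σ G x g ≈ g ⁻¹)
    twisted? g = σ G x g ≟ g ⁻¹
    square-one? : ∀ g → Dec (g ∙ g ≈ ε)
    square-one? g = g ∙ g ≟ ε
    twisted-resp : (λ g → σ G x g ≈ g ⁻¹) Respects _≈_
    twisted-resp g≈h σg≈g⁻¹ =
      trans (sym (∙-congʳ (∙-congˡ g≈h))) (trans σg≈g⁻¹ (⁻¹-cong g≈h))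

  card-ω≡ : card-ω G (σ G x) ≡ #involutions
  card-ω≡ = begin
    card-ω G (σ G x)
      ≡⟨ countG-translate omega? (inOmega-resp (σ G x)) x ⟩
    countG G (λ g → InOmegaEnum G (σ G x) (x ∙ g)) (λ g → omega? (x ∙ g))
      ≡⟨ countG-cong (λ g → omega? (x ∙ g)) involution? omega⇔involution ⟩
    #involutions
      ∎
    where
    omega? : Decidable (InOmegaEnum G (σ G x))
    omega? h = Any.any? (λ i → σ G x (enum i) ∙ enum i ⁻¹ ≟ h) (allFin size)
    omega⇔involution : ∀ g → InOmegaEnum G (σ G x) (x ∙ g) ⇔ IsInvolution G g
    omega⇔involution g =
      σ-commutator⇔involution one-class x-inv g
        ⇔-∘ inOmega⇔ (σ G x) (λ g≈h → ∙-congʳ (∙-congˡ g≈h)) (x ∙ g)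

lemma2p1 : {c ℓ : Level} (G : FiniteGroup c ℓ) → OneInvolutionClass G →
           (x : FiniteGroup.Carrier G) → IsInvolution G x →
           card-G-α G (σ G x) ≡ card-ω G (σ G x) + 1
lemma2p1 G one-class x x-inv =
  ≡.trans card-G-α≡ (≡.cong (_+ 1) (≡.sym card-ω≡))
  where open Counts G one-class x-inv
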